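{- For each $d$ there is a constant $b_d>1$ such that the following holds. Let $G$ be a graph without isolated vertices of maximum degree $d$ and let $U\subseteq V(G)$. Then $|\varphi(G)\leftarrow U|\le |\varphi(G)|/2^{|U|/b_d}$.
   Context: For a graph $G$ without isolated vertices, $\varphi(G)$ is the CNF whose variables are the vertices of $G$ and whose clauses are $(u\vee v)$ for all edges $\{u,v\}\in E(G)$. Boolean functions are identified with their sets of satisfying assignments, an assignment being viewed as a set of literals; $|\cdot|$ denotes the number of satisfying assignments. For $U\subseteq V(G)$ (viewed as a set of positive literals), $\varphi(G)\leftarrow U$ is the set of satisfying assignments of $\varphi(G)$ that contain every element of $U$ as a positive literal, i.e. assign all variables of $U$ true. -}

module Defs where

open import Data.Nat using (ℕ; zero; suc; _≤_; _+_)
open import Data.Bool using (Bool; true; false; not; _∨_; _∧_)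
open import Data.Bool.ListAction using (and)
open import Data.Fin using (Fin)
open import Data.Vec using (Vec; []; _∷_; lookup)
open import Data.List using (List; [_]; _++_; map) renaming (_∷_ to _∷ₗ_)
open import Data.List using (allFin) public
import Data.List
open import Data.Fin.Subset using (Subset; ∣_∣) public
open import Data.Product using (∃; _×_)
open import Relation.Binary.PropositionalEquality using (_≡_)

record Graph : Set where
  field
    n     : ℕ
    adj   : Fin n → Fin n → Bool
    sym   : ∀ u v → adj u v ≡ adj v u
    irrefl : ∀ u → adj u u ≡ false
open Graph public

countB : {A : Set} → (A → Bool) → List A → ℕ
countB p Data.List.[] = 0
countB p (x ∷ₗ xs) with p x
... | true  = suc (countB p xs)
... | false = countB p xs

degree : (G : Graph) → Fin (n G) → ℕ
degree G u = countB (adj G u) (allFin (n G))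

NoIsolated : Graph → Set
NoIsolated G = ∀ u → 1 ≤ degree G u

MaxDegree : Graph → ℕ → Set
MaxDegree G d = (∀ u → degree G u ≤ d) × ∃ λ u → degree G u ≡ d

allAssignments : ∀ m → List (Vec Bool m)
allAssignments zero = [ [] ]
allAssignments (suc m) =
  map (true ∷_) (allAssignments m) ++ map (false ∷_) (allAssignments m)

-- σ satisfies the clause (u ∨ v) whenever {u,v} is an edge
satisfiesφ : (G : Graph) → Vec Bool (n G) → Bool
satisfiesφ G σ =
  and (map (λ u → and (map (λ v → not (adj G u v) ∨ (lookup σ u ∨ lookup σ v))
                           (allFin (n G))))
           (allFin (n G)))

containsU : ∀ {m} → Subset m → Vec Bool m → Bool
containsU {m} U σ = and (map (λ u → not (lookup U u) ∨ lookup σ u) (allFin m))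

#φ : Graph → ℕ
#φ G = countB (satisfiesφ G) (allAssignments (n G))

#φ← : (G : Graph) → Subset (n G) → ℕ
#φ← G U = countB (λ σ → satisfiesφ G σ ∧ containsU U σ) (allAssignments (n G))

-- Write A(U) = |φ(G) ← U| and fix m ≥ 2^Δ, Δ the maximum degree.  The heart
-- of the proof is the inequality, for u ∈ U,
--
--     (1 + m) · A(U) ≤ m · A(U − u).                                  (★)
--
-- Split A(U − u) = Y + X by the value of u (Y: u true, X: u false); clearly
-- A(U) ≤ Y.  The models of φ(G) ← U form an up-closed family, and forcing a
-- variable to be true shrinks such a family by at most a factor 2, so forcing
-- the deg(u) neighbours of u costs at most 2^deg(u); afterwards switching u
-- off keeps φ(G) satisfied, an injection into the X-models.  Hence
-- A(U) ≤ 2^deg(u) · X, giving (★).  Iterating (★) yields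
-- (1 + m)^|U| · A(U) ≤ m^|U| · |φ(G)|, and Bernoulli's inequality
-- (1 + 1/m)^m ≥ 2 converts this to A(U)^m · 2^|U| ≤ |φ(G)|^m: the theorem
-- with b_d = p/q for p = 2^(d+1), q = 1.  The file follows this order:
-- counting over the cube, forcing in up-closed families, the graph facts,
-- (★) and its iteration, the arithmetic, and the theorem.
module Submission where

open import Defs
open import Data.Nat using (ℕ; _≤_; _<_; _*_; _^_)
open import Data.Product using (∃; _×_)

open import Data.Nat using (zero; suc; _+_; z≤n; s≤s; NonZero)
open import Data.Nat.Properties hiding (_≟_)
open import Data.Nat.Tactic.RingSolver using (solve-∀)
open import Data.Bool using (Bool; true; false; not; _∧_; _∨_)
open import Data.Bool.ListAction using (and)
open import Data.Fin using (Fin; zero; suc; _≟_)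
open import Data.Vec using (Vec; []; _∷_; lookup)
open import Data.List using (List; _++_; map) renaming ([] to []ₗ; _∷_ to _∷ₗ_)
open import Data.List.Membership.Propositional using (_∈_)
open import Data.List.Membership.Propositional.Properties using (∈-allFin)
open import Data.List.Relation.Unary.Any using (here; there)
open import Data.Product using (_,_)
open import Data.Empty using (⊥-elim)
open import Function using (_∘_)
open import Relation.Nullary using (yes; no)
open import Relation.Binary.PropositionalEquality as ≡
  using (_≡_; refl; cong; cong₂; subst; trans; _≢_; module ≡-Reasoning)

∧-intro : ∀ {a b} → a ≡ true → b ≡ true → a ∧ b ≡ true
∧-intro refl refl = refl

∧-fst : ∀ {a b} → a ∧ b ≡ true → a ≡ true
∧-fst {true} _ = refl

∧-snd : ∀ a {b} → a ∧ b ≡ true → b ≡ true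
∧-snd true e = e

∨-introˡ : ∀ {a} b → a ≡ true → a ∨ b ≡ true
∨-introˡ b refl = refl

∨-introʳ : ∀ a {b} → b ≡ true → a ∨ b ≡ true
∨-introʳ true  _    = refl
∨-introʳ false refl = refl

∨-mono : ∀ {a b a′ b′} → (a ≡ true → a′ ≡ true) → (b ≡ true → b′ ≡ true) →
         a ∨ b ≡ true → a′ ∨ b′ ≡ true
∨-mono {true}          {a′ = a′} {b′} f g _ = ∨-introˡ b′ (f refl)
∨-mono {false} {true}  {a′ = a′}      f g _ = ∨-introʳ a′ (g refl)

⇒-intro : ∀ a {b} → (a ≡ true → b ≡ true) → not a ∨ b ≡ true
⇒-intro true  h = h refl
⇒-intro false h = refl

⇒-elim : ∀ a {b} → not a ∨ b ≡ true → a ≡ true → b ≡ true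
⇒-elim true e refl = e

not-true : ∀ {a} → not a ≡ true → a ≡ false
not-true {false} _ = refl

and-intro : ∀ {A : Set} (f : A → Bool) (xs : List A) →
            (∀ {x} → x ∈ xs → f x ≡ true) → and (map f xs) ≡ true
and-intro f []ₗ       h = refl
and-intro f (x ∷ₗ xs) h = ∧-intro (h (here refl)) (and-intro f xs (h ∘ there))

and-elim : ∀ {A : Set} (f : A → Bool) (xs : List A) →
           and (map f xs) ≡ true → ∀ {x} → x ∈ xs → f x ≡ true
and-elim f (y ∷ₗ xs) e (here refl) = ∧-fst e
and-elim f (y ∷ₗ xs) e (there x∈) = and-elim f xs (∧-snd (f y) e) x∈

every-intro : ∀ {m} (f : Fin m → Bool) → (∀ x → f x ≡ true) →
              and (map f (allFin m)) ≡ true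
every-intro {m} f h = and-intro f (allFin m) (λ {x} _ → h x)

every-elim : ∀ {m} (f : Fin m → Bool) → and (map f (allFin m)) ≡ true →
             ∀ x → f x ≡ true
every-elim {m} f e x = and-elim f (allFin m) e (∈-allFin x)

count : ∀ m → (Vec Bool m → Bool) → ℕ
count m P = countB P (allAssignments m)

countB-++ : ∀ {A : Set} (p : A → Bool) (xs ys : List A) →
            countB p (xs ++ ys) ≡ countB p xs + countB p ys
countB-++ p []ₗ       ys = refl
countB-++ p (x ∷ₗ xs) ys with p x
... | true  = cong suc (countB-++ p xs ys)
... | false = countB-++ p xs ys

countB-map : ∀ {A B : Set} (p : B → Bool) (f : A → B) (xs : List A) →
             countB p (map f xs) ≡ countB (p ∘ f) xs
countB-map p f []ₗ       = refl
countB-map p f (x ∷ₗ xs) with p (f x)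
... | true  = cong suc (countB-map p f xs)
... | false = countB-map p f xs

count-cons : ∀ m (P : Vec Bool (suc m) → Bool) →
             count (suc m) P ≡ count m (P ∘ (true ∷_)) + count m (P ∘ (false ∷_))
count-cons m P = trans (countB-++ P (map (true ∷_) as) (map (false ∷_) as))
                       (cong₂ _+_ (countB-map P (true ∷_) as) (countB-map P (false ∷_) as))
  where as = allAssignments m

count-mono : ∀ m (P Q : Vec Bool m → Bool) →
             (∀ σ → P σ ≡ true → Q σ ≡ true) → count m P ≤ count m Q
count-mono m P Q h = go (allAssignments m)
  where
  go : ∀ σs → countB P σs ≤ countB Q σs
  go []ₗ = z≤n
  go (σ ∷ₗ σs) with P σ in eP | Q σ in eQ
  ... | true  | true  = s≤s (go σs)
  ... | true  | false with () ← trans (≡.sym (h σ eP)) eQ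
  ... | false | true  = m≤n⇒m≤1+n (go σs)
  ... | false | false = go σs

count-split : ∀ m (P Q : Vec Bool m → Bool) →
              count m P ≡ count m (λ σ → P σ ∧ Q σ) + count m (λ σ → P σ ∧ not (Q σ))
count-split m P Q = go (allAssignments m)
  where
  go : ∀ σs → countB P σs ≡ countB (λ σ → P σ ∧ Q σ) σs + countB (λ σ → P σ ∧ not (Q σ)) σs
  go []ₗ = refl
  go (σ ∷ₗ σs) with P σ | Q σ
  ... | true  | true  = cong suc (go σs)
  ... | true  | false = trans (cong suc (go σs)) (≡.sym (+-suc _ _))
  ... | false | _     = go σs

toggle : ∀ {m} → Fin m → Vec Bool m → Vec Bool m
toggle zero    (x ∷ σ) = not x ∷ σ
toggle (suc i) (x ∷ σ) = x ∷ toggle i σ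

toggle-same : ∀ {m} (i : Fin m) σ → lookup (toggle i σ) i ≡ not (lookup σ i)
toggle-same zero    (x ∷ σ) = refl
toggle-same (suc i) (x ∷ σ) = toggle-same i σ

toggle-other : ∀ {m} {i j : Fin m} σ → i ≢ j → lookup (toggle i σ) j ≡ lookup σ j
toggle-other {i = zero}  {zero}  σ       i≢j = ⊥-elim (i≢j refl)
toggle-other {i = zero}  {suc j} (x ∷ σ) i≢j = refl
toggle-other {i = suc i} {zero}  (x ∷ σ) i≢j = refl
toggle-other {i = suc i} {suc j} (x ∷ σ) i≢j = toggle-other σ (i≢j ∘ cong suc)

-- Toggling a variable is a bijection of the cube, so it preserves counts.
count-toggle : ∀ m (i : Fin m) (P : Vec Bool m → Bool) → count m P ≡ count m (P ∘ toggle i)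
count-toggle (suc m) zero P = begin
  count (suc m) P                                   ≡⟨ count-cons m P ⟩
  count m (P ∘ (true ∷_)) + count m (P ∘ (false ∷_)) ≡⟨ +-comm (count m (P ∘ (true ∷_))) _ ⟩
  count m (P ∘ (false ∷_)) + count m (P ∘ (true ∷_)) ≡⟨ ≡.sym (count-cons m (P ∘ toggle zero)) ⟩
  count (suc m) (P ∘ toggle zero)                   ∎
  where open ≡-Reasoning
count-toggle (suc m) (suc i) P = begin
  count (suc m) P                                     ≡⟨ count-cons m P ⟩
  count m (P ∘ (true ∷_)) + count m (P ∘ (false ∷_))   ≡⟨ cong₂ _+_ (count-toggle m i (P ∘ (true ∷_)))
                                                                   (count-toggle m i (P ∘ (false ∷_))) ⟩
  count m (P ∘ (true ∷_) ∘ toggle i) + count m (P ∘ (false ∷_) ∘ toggle i)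
                                                      ≡⟨ ≡.sym (count-cons m (P ∘ toggle (suc i))) ⟩
  count (suc m) (P ∘ toggle (suc i))                  ∎
  where open ≡-Reasoning

count-inj : ∀ m (i : Fin m) (P Q : Vec Bool m → Bool) →
            (∀ σ → P σ ≡ true → Q (toggle i σ) ≡ true) → count m P ≤ count m Q
count-inj m i P Q h = ≤-trans (count-mono m P (Q ∘ toggle i) h)
                              (≤-reflexive (≡.sym (count-toggle m i Q)))

-- Up-closed predicates and the cost of forcing variables

_≼_ : ∀ {m} → Vec Bool m → Vec Bool m → Set
σ ≼ τ = ∀ j → lookup σ j ≡ true → lookup τ j ≡ true

UpClosed : ∀ {m} → (Vec Bool m → Bool) → Set
UpClosed P = ∀ σ τ → σ ≼ τ → P σ ≡ true → P τ ≡ true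

∧-upClosed : ∀ {m} {P Q : Vec Bool m → Bool} → UpClosed P → UpClosed Q →
             UpClosed (λ σ → P σ ∧ Q σ)
∧-upClosed {P = P} hP hQ σ τ le e = ∧-intro (hP σ τ le (∧-fst e)) (hQ σ τ le (∧-snd (P σ) e))

toggle-raises : ∀ {m} (i : Fin m) σ → lookup σ i ≡ false → σ ≼ toggle i σ
toggle-raises i σ σi j σj with i ≟ j
... | yes refl with () ← trans (≡.sym σi) σj
... | no i≢j = trans (toggle-other σ i≢j) σj

toggle-lowers : ∀ {m} (i : Fin m) σ → lookup σ i ≡ true → toggle i σ ≼ σ
toggle-lowers i σ σi j τj with i ≟ j
... | yes refl = σi
... | no i≢j = trans (≡.sym (toggle-other σ i≢j)) τj

-- forcedOn S ws σ: σ makes true every variable of ws selected by S.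
-- For S = lookup U and ws = allFin m this is exactly containsU U.
forcedOn : ∀ {m} → (Fin m → Bool) → List (Fin m) → Vec Bool m → Bool
forcedOn S ws σ = and (map (λ w → not (S w) ∨ lookup σ w) ws)

forcedOn-upClosed : ∀ {m} (S : Fin m → Bool) ws → UpClosed (forcedOn S ws)
forcedOn-upClosed S []ₗ       σ τ le e = refl
forcedOn-upClosed S (w ∷ₗ ws) σ τ le e =
  ∧-intro (∨-mono {not (S w)} (λ x → x) (le w) (∧-fst e))
          (forcedOn-upClosed S ws σ τ le (∧-snd (not (S w) ∨ lookup σ w) e))

forcedOn-all-elim : ∀ {m} (S : Fin m → Bool) σ → forcedOn S (allFin m) σ ≡ true →
                    ∀ w → S w ≡ true → lookup σ w ≡ true
forcedOn-all-elim S σ e w = ⇒-elim (S w) (every-elim _ e w)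

forcedOn-all-intro : ∀ {m} (S : Fin m → Bool) σ → (∀ w → S w ≡ true → lookup σ w ≡ true) →
                     forcedOn S (allFin m) σ ≡ true
forcedOn-all-intro S σ h = every-intro _ (λ w → ⇒-intro (S w) (h w))

-- Requiring one more variable to be true halves an up-closed family at most:
-- the assignments with σ i false inject into those with σ i true.
count-raise : ∀ m (P : Vec Bool m → Bool) → UpClosed P → ∀ i →
              count m P ≤ 2 * count m (λ σ → P σ ∧ lookup σ i)
count-raise m P up i = begin
  count m P                  ≡⟨ count-split m P (λ σ → lookup σ i) ⟩
  Pon + count m (λ σ → P σ ∧ not (lookup σ i)) ≤⟨ +-monoʳ-≤ Pon off≤on ⟩
  Pon + Pon                  ≡⟨ cong (Pon +_) (≡.sym (+-identityʳ Pon)) ⟩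
  2 * Pon                    ∎
  where
  open ≤-Reasoning
  Pon = count m (λ σ → P σ ∧ lookup σ i)
  off≤on : count m (λ σ → P σ ∧ not (lookup σ i)) ≤ Pon
  off≤on = count-inj m i _ _ λ σ e →
    let σi = not-true (∧-snd (P σ) e)
    in ∧-intro (up σ (toggle i σ) (toggle-raises i σ σi) (∧-fst e)) (trans (toggle-same i σ) (cong not σi))

count-force : ∀ m (P : Vec Bool m → Bool) → UpClosed P → ∀ (S : Fin m → Bool) ws →
              count m P ≤ 2 ^ countB S ws * count m (λ σ → P σ ∧ forcedOn S ws σ)
count-force m P up S []ₗ =
  ≤-trans (count-mono m P _ (λ σ e → ∧-intro e refl)) (≤-reflexive (≡.sym (*-identityˡ _)))
count-force m P up S (w ∷ₗ ws) with S w
... | false = count-force m P up S ws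
... | true = begin
  count m P                                 ≤⟨ count-force m P up S ws ⟩
  2 ^ k * count m Pws                       ≤⟨ *-monoʳ-≤ (2 ^ k) (count-raise m Pws up′ w) ⟩
  2 ^ k * (2 * count m (λ σ → Pws σ ∧ lookup σ w))
                                            ≤⟨ *-monoʳ-≤ (2 ^ k) (*-monoʳ-≤ 2 (count-mono m _ _ reorder)) ⟩
  2 ^ k * (2 * count m Pw∷ws)               ≡⟨ swap-factor (2 ^ k) (count m Pw∷ws) ⟩
  2 * 2 ^ k * count m Pw∷ws                 ∎
  where
  open ≤-Reasoning
  k = countB S ws
  Pws = λ σ → P σ ∧ forcedOn S ws σ
  Pw∷ws = λ σ → P σ ∧ (lookup σ w ∧ forcedOn S ws σ)
  up′ : UpClosed Pws
  up′ = ∧-upClosed up (forcedOn-upClosed S ws)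
  reorder : ∀ σ → Pws σ ∧ lookup σ w ≡ true → Pw∷ws σ ≡ true
  reorder σ e = ∧-intro (∧-fst {P σ} (∧-fst {Pws σ} e)) (∧-intro (∧-snd (Pws σ) e) (∧-snd (P σ) (∧-fst e)))
  swap-factor : ∀ a x → a * (2 * x) ≡ 2 * a * x
  swap-factor = solve-∀

sat-elim : ∀ G σ → satisfiesφ G σ ≡ true →
           ∀ u v → adj G u v ≡ true → lookup σ u ∨ lookup σ v ≡ true
sat-elim G σ e u v = ⇒-elim (adj G u v) (every-elim _ (every-elim _ e u) v)

sat-intro : ∀ G σ → (∀ u v → adj G u v ≡ true → lookup σ u ∨ lookup σ v ≡ true) →
            satisfiesφ G σ ≡ true
sat-intro G σ h = every-intro _ (λ u → every-intro _ (λ v → ⇒-intro (adj G u v) (h u v)))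

sat-upClosed : ∀ G → UpClosed (satisfiesφ G)
sat-upClosed G σ τ le e =
  sat-intro G τ (λ u v uv → ∨-mono (le u) (le v) (sat-elim G σ e u v uv))

Models : (G : Graph) → Subset (n G) → Vec Bool (n G) → Bool
Models G U σ = satisfiesφ G σ ∧ containsU U σ

Models-upClosed : ∀ G U → UpClosed (Models G U)
Models-upClosed G U = ∧-upClosed (sat-upClosed G) (forcedOn-upClosed (lookup U) (allFin (n G)))

containsU-antitone : ∀ {m} (U V : Subset m) σ → V ≼ U →
                     containsU U σ ≡ true → containsU V σ ≡ true
containsU-antitone U V σ V≼U e =
  forcedOn-all-intro (lookup V) σ (λ w Vw → forcedOn-all-elim (lookup U) σ e w (V≼U w Vw))

containsU-toggle-outside : ∀ {m} (U : Subset m) u σ → lookup U u ≡ false →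
                           containsU U σ ≡ true → containsU U (toggle u σ) ≡ true
containsU-toggle-outside U u σ Uu e = forcedOn-all-intro (lookup U) (toggle u σ) constrained
  where
  constrained : ∀ w → lookup U w ≡ true → lookup (toggle u σ) w ≡ true
  constrained w Uw with u ≟ w
  ... | yes refl with () ← trans (≡.sym Uu) Uw
  ... | no u≢w = trans (toggle-other σ u≢w) (forcedOn-all-elim (lookup U) σ e w Uw)

NeighboursTrue : (G : Graph) → Fin (n G) → Vec Bool (n G) → Bool
NeighboursTrue G u = forcedOn (adj G u) (allFin (n G))

neighbour-distinct : ∀ G {u w} → adj G u w ≡ true → u ≢ w
neighbour-distinct G {u} uw refl with () ← trans (≡.sym (irrefl G u)) uw

-- Once all neighbours of u are true, u occurs only in satisfied clauses,
-- so its value can be changed without falsifying φ(G).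
sat-toggle-free : ∀ G u σ → satisfiesφ G σ ≡ true → NeighboursTrue G u σ ≡ true →
                  satisfiesφ G (toggle u σ) ≡ true
sat-toggle-free G u σ sat nb = sat-intro G τ clause
  where
  τ = toggle u σ
  neighbour-true : ∀ w → adj G u w ≡ true → lookup τ w ≡ true
  neighbour-true w uw = trans (toggle-other σ (neighbour-distinct G uw))
                              (forcedOn-all-elim (adj G u) σ nb w uw)
  clause : ∀ x y → adj G x y ≡ true → lookup τ x ∨ lookup τ y ≡ true
  clause x y xy with u ≟ x | u ≟ y
  ... | yes refl | _        = ∨-introʳ (lookup τ x) (neighbour-true y xy)
  ... | no _     | yes refl = ∨-introˡ (lookup τ y) (neighbour-true x (trans (Graph.sym G y x) xy))
  ... | no u≢x   | no u≢y   =
    subst (λ b → b ≡ true) (≡.sym (cong₂ _∨_ (toggle-other σ u≢x) (toggle-other σ u≢y)))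
          (sat-elim G σ sat x y xy)

-- Releasing one vertex of U: the inequality (★)

module Release (G : Graph) (U : Subset (n G)) (u : Fin (n G)) (u∈U : lookup U u ≡ true) where

  -- U − u, realised by toggling u, together with its two defining properties.
  U⁻ : Subset (n G)
  U⁻ = toggle u U

  U⁻≼U : U⁻ ≼ U
  U⁻≼U = toggle-lowers u U u∈U

  u∉U⁻ : lookup U⁻ u ≡ false
  u∉U⁻ = trans (toggle-same u U) (cong not u∈U)

  Y X : ℕ
  Y = count (n G) (λ σ → Models G U⁻ σ ∧ lookup σ u)
  X = count (n G) (λ σ → Models G U⁻ σ ∧ not (lookup σ u))

  release-split : #φ← G U⁻ ≡ Y + X
  release-split = count-split (n G) (Models G U⁻) (λ σ → lookup σ u)

  models≤Y : #φ← G U ≤ Y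
  models≤Y = count-mono (n G) _ _ λ σ e →
    let contains = ∧-snd (satisfiesφ G σ) e
    in ∧-intro (∧-intro (∧-fst e) (containsU-antitone U U⁻ σ U⁻≼U contains))
               (forcedOn-all-elim (lookup U) σ contains u u∈U)

  switch-off : ∀ σ → Models G U σ ∧ NeighboursTrue G u σ ≡ true →
               Models G U⁻ (toggle u σ) ∧ not (lookup (toggle u σ) u) ≡ true
  switch-off σ e = ∧-intro (∧-intro sat′ contains′) u-off
    where
    model = ∧-fst e
    contains = ∧-snd (satisfiesφ G σ) model
    sat′ = sat-toggle-free G u σ (∧-fst model) (∧-snd (Models G U σ) e)
    contains′ = containsU-toggle-outside U⁻ u σ u∉U⁻ (containsU-antitone U U⁻ σ U⁻≼U contains)
    u-off : not (lookup (toggle u σ) u) ≡ true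
    u-off = cong not (trans (toggle-same u σ)
                            (cong not (forcedOn-all-elim (lookup U) σ contains u u∈U)))

  -- Forcing the neighbours of u and then switching u off: A(U) ≤ 2^deg(u) · X.
  models≤X : #φ← G U ≤ 2 ^ degree G u * X
  models≤X = ≤-trans (count-force (n G) (Models G U) (Models-upClosed G U) (adj G u) (allFin (n G)))
                     (*-monoʳ-≤ (2 ^ degree G u) (count-inj (n G) u _ _ switch-off))

  release : ∀ m → 2 ^ degree G u ≤ m → suc m * #φ← G U ≤ m * #φ← G U⁻
  release m deg≤m = begin
    suc m * A                ≡⟨ +-comm A (m * A) ⟩
    m * A + A                ≤⟨ +-mono-≤ (*-monoʳ-≤ m models≤Y) models≤X ⟩
    m * Y + 2 ^ degree G u * X ≤⟨ +-monoʳ-≤ (m * Y) (*-monoˡ-≤ X deg≤m) ⟩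
    m * Y + m * X            ≡⟨ ≡.sym (*-distribˡ-+ m Y X) ⟩
    m * (Y + X)              ≡⟨ cong (m *_) (≡.sym release-split) ⟩
    m * #φ← G U⁻             ∎
    where
    open ≤-Reasoning
    A = #φ← G U

pick : ∀ {m} (U : Subset m) {k} → ∣ U ∣ ≡ suc k →
       ∃ λ u → lookup U u ≡ true × ∣ toggle u U ∣ ≡ k
pick (true ∷ U)  e = zero , refl , suc-injective e
pick (false ∷ U) e with pick U e
... | u , u∈U , size = suc u , u∈U , size

release-all : ∀ G m → (∀ u → 2 ^ degree G u ≤ m) → ∀ k (U : Subset (n G)) → ∣ U ∣ ≡ k →
              suc m ^ k * #φ← G U ≤ m ^ k * #φ G
release-all G m deg≤m zero U _ =
  *-monoʳ-≤ 1 (count-mono (n G) (Models G U) (satisfiesφ G) (λ σ → ∧-fst))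
release-all G m deg≤m (suc k) U size with pick U size
... | u , u∈U , size⁻ = begin
  suc m * suc m ^ k * A        ≡⟨ reassoc (suc m) (suc m ^ k) A ⟩
  suc m ^ k * (suc m * A)      ≤⟨ *-monoʳ-≤ (suc m ^ k) (release m (deg≤m u)) ⟩
  suc m ^ k * (m * A⁻)         ≡⟨ reassoc′ (suc m ^ k) m A⁻ ⟩
  m * (suc m ^ k * A⁻)         ≤⟨ *-monoʳ-≤ m (release-all G m deg≤m k U⁻ size⁻) ⟩
  m * (m ^ k * #φ G)           ≡⟨ ≡.sym (*-assoc m (m ^ k) (#φ G)) ⟩
  m * m ^ k * #φ G             ∎
  where
  open ≤-Reasoning
  open Release G U u u∈U
  A = #φ← G U
  A⁻ = #φ← G U⁻
  reassoc : ∀ s p a → s * p * a ≡ p * (s * a)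
  reassoc = solve-∀
  reassoc′ : ∀ p s a → p * (s * a) ≡ s * (p * a)
  reassoc′ = solve-∀

-- Arithmetic: from the geometric bound to the stated form

-- Bernoulli's inequality (1 + 1/x)^j ≥ 1 + j/x, multiplied out.
bernoulli : ∀ x j → x ^ j * (x + j) ≤ x * suc x ^ j
bernoulli x zero = ≤-reflexive (base x)
  where
  base : ∀ x → 1 * (x + 0) ≡ x * 1
  base = solve-∀
bernoulli x (suc j) = begin
  x * x ^ j * (x + suc j)                  ≡⟨ expand x (x ^ j) j ⟩
  x * (x ^ j * (x + j)) + x * x ^ j        ≤⟨ +-monoʳ-≤ (x * (x ^ j * (x + j)))
                                                (≤-trans (≤-reflexive (*-comm x (x ^ j)))
                                                         (*-monoʳ-≤ (x ^ j) (m≤m+n x j))) ⟩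
  x * (x ^ j * (x + j)) + x ^ j * (x + j)  ≡⟨ collect x (x ^ j * (x + j)) ⟩
  suc x * (x ^ j * (x + j))                ≤⟨ *-monoʳ-≤ (suc x) (bernoulli x j) ⟩
  suc x * (x * suc x ^ j)                  ≡⟨ *-comm-middle (suc x) x (suc x ^ j) ⟩
  x * (suc x * suc x ^ j)                  ∎
  where
  open ≤-Reasoning
  expand : ∀ x p j → x * p * (x + suc j) ≡ x * (p * (x + j)) + x * p
  expand = solve-∀
  collect : ∀ x q → x * q + q ≡ suc x * q
  collect = solve-∀
  *-comm-middle : ∀ a b c → a * (b * c) ≡ b * (a * c)
  *-comm-middle = solve-∀

bernoulli-doubling : ∀ x .{{_ : NonZero x}} → 2 * x ^ x ≤ suc x ^ x
bernoulli-doubling x = *-cancelˡ-≤ x (begin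
  x * (2 * x ^ x)   ≡⟨ rearrange x (x ^ x) ⟩
  x ^ x * (x + x)   ≤⟨ bernoulli x x ⟩
  x * suc x ^ x     ∎)
  where
  open ≤-Reasoning
  rearrange : ∀ x p → x * (2 * p) ≡ p * (x + x)
  rearrange = solve-∀

^-distribʳ-* : ∀ x y j → (x * y) ^ j ≡ x ^ j * y ^ j
^-distribʳ-* x y zero    = refl
^-distribʳ-* x y (suc j) = trans (cong (x * y *_) (^-distribʳ-* x y j)) (interchange x y (x ^ j) (y ^ j))
  where
  interchange : ∀ x y p q → x * y * (p * q) ≡ x * p * (y * q)
  interchange = solve-∀

^-swap : ∀ x k j → (x ^ k) ^ j ≡ (x ^ j) ^ k
^-swap x k j = trans (^-*-assoc x k j) (trans (cong (x ^_) (*-comm k j)) (≡.sym (^-*-assoc x j k)))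

-- (1 + m)^k · A ≤ m^k · N  implies  A^m · 2^k ≤ N^m:  raise to the power m
-- and use (1 + m)^m ≥ 2 · m^m.
geometric⇒power : ∀ m .{{_ : NonZero m}} k A N → suc m ^ k * A ≤ m ^ k * N → A ^ m * 2 ^ k ≤ N ^ m
geometric⇒power m k A N bound = *-cancelˡ-≤ ((m ^ m) ^ k) {{m^n≢0 (m ^ m) k {{m^n≢0 m m}}}} (begin
  (m ^ m) ^ k * (A ^ m * 2 ^ k)  ≡⟨ rearrange ((m ^ m) ^ k) (A ^ m) (2 ^ k) ⟩
  (2 ^ k * (m ^ m) ^ k) * A ^ m  ≡⟨ cong (_* A ^ m) (≡.sym (^-distribʳ-* 2 (m ^ m) k)) ⟩
  (2 * m ^ m) ^ k * A ^ m        ≤⟨ *-monoˡ-≤ (A ^ m) (^-monoˡ-≤ k (bernoulli-doubling m)) ⟩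
  (suc m ^ m) ^ k * A ^ m        ≡⟨ cong (_* A ^ m) (^-swap (suc m) m k) ⟩
  (suc m ^ k) ^ m * A ^ m        ≡⟨ ≡.sym (^-distribʳ-* (suc m ^ k) A m) ⟩
  (suc m ^ k * A) ^ m            ≤⟨ ^-monoˡ-≤ m bound ⟩
  (m ^ k * N) ^ m                ≡⟨ ^-distribʳ-* (m ^ k) N m ⟩
  (m ^ k) ^ m * N ^ m            ≡⟨ cong (_* N ^ m) (^-swap m k m) ⟩
  (m ^ m) ^ k * N ^ m            ∎)
  where
  open ≤-Reasoning
  rearrange : ∀ p q r → p * (q * r) ≡ (r * p) * q
  rearrange = solve-∀

theorem4 : ∀ (d : ℕ) → ∃ λ p → ∃ λ q → 1 ≤ q × q < p ×
    (∀ (G : Graph) → NoIsolated G → MaxDegree G d →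
    ∀ (U : Subset (n G)) → #φ← G U ^ p * 2 ^ (∣ U ∣ * q) ≤ #φ G ^ p)
theorem4 d = m , 1 , ≤-refl , 1<m , bound
  where
  m = 2 ^ suc d
  instance
    m≢0 : NonZero m
    m≢0 = m^n≢0 2 (suc d)
  1<m : 1 < m
  1<m = *-monoʳ-≤ 2 (m^n>0 2 d)
  bound : ∀ (G : Graph) → NoIsolated G → MaxDegree G d →
          ∀ (U : Subset (n G)) → #φ← G U ^ m * 2 ^ (∣ U ∣ * 1) ≤ #φ G ^ m
  bound G _ (deg≤d , _) U rewrite *-identityʳ ∣ U ∣ =
    geometric⇒power m ∣ U ∣ (#φ← G U) (#φ G)
      (release-all G m (λ u → ^-monoʳ-≤ 2 (m≤n⇒m≤1+n (deg≤d u))) ∣ U ∣ U refl)
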